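{- Let $b\geq 2$ be an integer. For any nonnegative integers $n$ and $m$, \[ S_b(m+n)\geq S_b(m)+S_b(n)+\min\{m,n\}. \]
   Context: For an integer $b\geq 2$ and $n\in\mathbb{Z}_{\ge 0}$, $s_b(n)$ denotes the sum of the digits of $n$ in base $b$, and $S_b(N)=\sum_{n=0}^{N-1}s_b(n)$ for $N\in\mathbb{Z}_{\ge0}$ (so $S_b(0)=0$). -}

module Defs where

open import Data.Nat using (ℕ; zero; suc; _+_; _≤_; NonZero)
open import Data.Nat.DivMod using (_/_; _%_)

-- Base-b digit sum with fuel. Since n / b < n for n ≥ 1 and b ≥ 2,
-- fuel n suffices for computing s_b(n) (n / b reaches 0 in at most n steps).
digitSumFuel : (b : ℕ) → .{{NonZero b}} → ℕ → ℕ → ℕ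
digitSumFuel b zero    n = 0
digitSumFuel b (suc f) zero = 0
digitSumFuel b (suc f) n@(suc _) = n % b + digitSumFuel b f (n / b)

s : (b : ℕ) → .{{NonZero b}} → ℕ → ℕ
s b n = digitSumFuel b n n

S : (b : ℕ) → .{{NonZero b}} → ℕ → ℕ
S b zero    = 0
S b (suc N) = S b N + s b N

module Submission where

-- Write m = r + q·b and n = t + p·b with digits r, t < b.  Summing
-- s_b over the b residue classes of the last digit gives the closed form
--     S_b(r + k·b) = b·S_b(k) + k·tri(b) + r·s_b(k) + tri(r),
-- where tri(r) = 0 + 1 + ⋯ + (r − 1).  Assume m ≤ n and argue by strong induction
-- on m + n.  If r + t < b there is no carry: m + n = (r + t) + (q + p)·b, and
-- splitting b = r + t + c the right-hand side becomes a combination, with weights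
-- c, r and t, of the inequality for the smaller pairs (q, p), (q+1, p), (q, p+1).
-- If r + t ≥ b there is a carry: m + n = u + (q + p + 1)·b with u = r + t − b, and
-- splitting b = c₁ + c₂ + u (r = c₁ + u, t = c₂ + u) the weights c₁, c₂, u go to
-- the pairs (q+1, p), (q, p+1), (q+1, p+1).  In both cases what is left over is
-- an elementary bound for min(m, n) = m.

open import Defs
open import Data.Nat
  using (ℕ; zero; suc; _+_; _*_; _≤_; _<_; _⊓_; NonZero; >-nonZero; z≤n; s≤s; _<?_)
open import Data.Nat.Properties
open import Data.Nat.DivMod
open import Data.Nat.Divisibility using (divides)
open import Data.Nat.Induction using (<-rec)
open import Data.Nat.Tactic.RingSolver using (solve-∀)
open import Data.Product using (_,_)
open import Data.Sum using (inj₁; inj₂)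
open import Relation.Nullary using (yes; no)
open import Relation.Binary.PropositionalEquality

tri : ℕ → ℕ
tri zero    = 0
tri (suc r) = tri r + r

tri-+ : ∀ a c → tri (a + c) ≡ tri a + tri c + a * c
tri-+ zero    c = sym (+-identityʳ (tri c))
tri-+ (suc a) c rewrite tri-+ a c = shuffle (tri a) (tri c) a c
  where
  shuffle : ∀ x y a c → x + y + a * c + (a + c) ≡ x + a + y + (c + a * c)
  shuffle = solve-∀

tri-carry : ∀ c₁ c₂ u → tri (c₁ + u) + tri (c₂ + u) + c₁ * c₂ ≡ tri (c₁ + c₂ + u) + tri u
tri-carry c₁ c₂ u
  rewrite tri-+ c₁ u | tri-+ c₂ u | tri-+ (c₁ + c₂) u | tri-+ c₁ c₂
  = expand (tri c₁) (tri c₂) (tri u) c₁ c₂ u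
  where
  expand : ∀ x y z c₁ c₂ u →
    x + z + c₁ * u + (y + z + c₂ * u) + c₁ * c₂ ≡ x + y + c₁ * c₂ + z + (c₁ + c₂) * u + z
  expand = solve-∀

≤-self-* : ∀ {r t} → r ≤ t → r ≤ r * t
≤-self-* {zero}  _             = z≤n
≤-self-* {suc r} {suc t} _ = m≤m*n (suc r) (suc t)

-- Case without carry, in abstract form.  With b = r + t + c, the digit formulas
-- for S(m) and S(n) plus a bound M on min(m, n) are dominated by the digit formula
-- for S(m + n), given the three weighted instances of the inequality (A = S q,
-- B = S p, X = S(q + p), sq, sp, sx the corresponding digit sums, a₀ a₁ a₂ minima).
no-carry-combine : ∀ {b c r t q p T A B X sq sp sx a₀ a₁ a₂ M} → b ≡ r + t + c →
  c * (A + B + a₀) ≤ c * X →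
  r * ((A + sq) + B + a₁) ≤ r * (X + sx) →
  t * (A + (B + sp) + a₂) ≤ t * (X + sx) →
  M ≤ c * a₀ + r * a₁ + t * a₂ + r * t →
  (b * A + q * T + r * sq + tri r) + (b * B + p * T + t * sp + tri t) + M
    ≤ b * X + (q + p) * T + (r + t) * sx + tri (r + t)
no-carry-combine {c = c} {r} {t} {q} {p} {T} {A} {B} {X} {sq} {sp} {sx} {a₀} {a₁} {a₂} {M}
  refl h₀ h₁ h₂ hM = begin
    L + M
      ≤⟨ +-monoʳ-≤ L hM ⟩
    L + (c * a₀ + r * a₁ + t * a₂ + r * t)
      ≡⟨ regroup c r t q p T A B sq sp a₀ a₁ a₂ (tri r) (tri t) ⟩
    (c * (A + B + a₀) + r * ((A + sq) + B + a₁) + t * (A + (B + sp) + a₂))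
      + ((q + p) * T + (tri r + tri t + r * t))
      ≤⟨ +-mono-≤ (+-mono-≤ (+-mono-≤ h₀ h₁) h₂)
                  (≤-reflexive (cong ((q + p) * T +_) (sym (tri-+ r t)))) ⟩
    (c * X + r * (X + sx) + t * (X + sx)) + ((q + p) * T + tri (r + t))
      ≡⟨ collect c r t q p T X sx (tri (r + t)) ⟩
    (r + t + c) * X + (q + p) * T + (r + t) * sx + tri (r + t) ∎
  where
  open ≤-Reasoning
  L = ((r + t + c) * A + q * T + r * sq + tri r) + ((r + t + c) * B + p * T + t * sp + tri t)
  regroup : ∀ c r t q p T A B sq sp a₀ a₁ a₂ x y →
    ((r + t + c) * A + q * T + r * sq + x) + ((r + t + c) * B + p * T + t * sp + y)
      + (c * a₀ + r * a₁ + t * a₂ + r * t)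
    ≡ (c * (A + B + a₀) + r * ((A + sq) + B + a₁) + t * (A + (B + sp) + a₂))
      + ((q + p) * T + (x + y + r * t))
  regroup = solve-∀
  collect : ∀ c r t q p T X sx z →
    (c * X + r * (X + sx) + t * (X + sx)) + ((q + p) * T + z)
    ≡ (r + t + c) * X + (q + p) * T + (r + t) * sx + z
  collect = solve-∀

-- Case with carry, in abstract form: b = c₁ + c₂ + u, r = c₁ + u, t = c₂ + u, and
-- the weighted instances now concern X = S(q + p + 1) and X + Z = S(q + p + 2).
carry-combine : ∀ {b r t c₁ c₂ u q p A B X Z sq sp a₁ a₂ a₃ M} →
  b ≡ c₁ + c₂ + u → r ≡ c₁ + u → t ≡ c₂ + u →
  c₁ * ((A + sq) + B + a₁) ≤ c₁ * X →
  c₂ * (A + (B + sp) + a₂) ≤ c₂ * X →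
  u * ((A + sq) + (B + sp) + a₃) ≤ u * (X + Z) →
  M ≤ c₁ * a₁ + c₂ * a₂ + u * a₃ + c₁ * c₂ →
  (b * A + q * tri b + r * sq + tri r) + (b * B + p * tri b + t * sp + tri t) + M
    ≤ b * X + suc (q + p) * tri b + u * Z + tri u
carry-combine {c₁ = c₁} {c₂} {u} {q} {p} {A} {B} {X} {Z} {sq} {sp} {a₁} {a₂} {a₃} {M}
  refl refl refl h₁ h₂ h₃ hM = begin
    L + M
      ≤⟨ +-monoʳ-≤ L hM ⟩
    L + (c₁ * a₁ + c₂ * a₂ + u * a₃ + c₁ * c₂)
      ≡⟨ regroup c₁ c₂ u q p T A B sq sp a₁ a₂ a₃ (tri (c₁ + u)) (tri (c₂ + u)) ⟩
    W + (q * T + p * T + (tri (c₁ + u) + tri (c₂ + u) + c₁ * c₂))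
      ≡⟨ cong (λ z → W + (q * T + p * T + z)) (tri-carry c₁ c₂ u) ⟩
    W + (q * T + p * T + (T + tri u))
      ≤⟨ +-monoˡ-≤ (q * T + p * T + (T + tri u)) (+-mono-≤ (+-mono-≤ h₁ h₂) h₃) ⟩
    (c₁ * X + c₂ * X + u * (X + Z)) + (q * T + p * T + (T + tri u))
      ≡⟨ collect c₁ c₂ u q p T X Z (tri u) ⟩
    (c₁ + c₂ + u) * X + suc (q + p) * T + u * Z + tri u ∎
  where
  open ≤-Reasoning
  T = tri (c₁ + c₂ + u)
  L = ((c₁ + c₂ + u) * A + q * T + (c₁ + u) * sq + tri (c₁ + u))
      + ((c₁ + c₂ + u) * B + p * T + (c₂ + u) * sp + tri (c₂ + u))
  W = c₁ * ((A + sq) + B + a₁) + c₂ * (A + (B + sp) + a₂) + u * ((A + sq) + (B + sp) + a₃)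
  regroup : ∀ c₁ c₂ u q p T A B sq sp a₁ a₂ a₃ x y →
    ((c₁ + c₂ + u) * A + q * T + (c₁ + u) * sq + x) + ((c₁ + c₂ + u) * B + p * T + (c₂ + u) * sp + y)
      + (c₁ * a₁ + c₂ * a₂ + u * a₃ + c₁ * c₂)
    ≡ (c₁ * ((A + sq) + B + a₁) + c₂ * (A + (B + sp) + a₂) + u * ((A + sq) + (B + sp) + a₃))
      + (q * T + p * T + (x + y + c₁ * c₂))
  regroup = solve-∀
  collect : ∀ c₁ c₂ u q p T X Z z →
    (c₁ * X + c₂ * X + u * (X + Z)) + (q * T + p * T + (T + z))
    ≡ (c₁ + c₂ + u) * X + suc (q + p) * T + u * Z + z
  collect = solve-∀

-- The leftover bound for min(m, n) = m = r + q·b in the case without carry.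
-- Here q ≤ p, and when q = p the assumption m ≤ n gives r ≤ t.
min-no-carry : ∀ r t c {b q p} → b ≡ r + t + c → q ≤ p → (q ≡ p → r ≤ t) →
  r + q * b ≤ c * (q ⊓ p) + r * (suc q ⊓ p) + t * (q ⊓ suc p) + r * t
min-no-carry r t c {q = q} refl q≤p r≤t
  rewrite m≤n⇒m⊓n≡m q≤p | m≤n⇒m⊓n≡m (m≤n⇒m≤1+n q≤p) with m≤n⇒m<n∨m≡n q≤p
... | inj₁ q<p rewrite m≤n⇒m⊓n≡m q<p =
  ≤-trans (m≤m+n (r + q * (r + t + c)) (r * t)) (≤-reflexive (expand c r t q))
  where
  expand : ∀ c r t q → r + q * (r + t + c) + r * t ≡ c * q + r * suc q + t * q + r * t
  expand = solve-∀
... | inj₂ refl rewrite m≥n⇒m⊓n≡n (n≤1+n q) = begin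
    r + q * (r + t + c)     ≡⟨ +-comm r _ ⟩
    q * (r + t + c) + r     ≤⟨ +-monoʳ-≤ (q * (r + t + c)) (≤-self-* (r≤t refl)) ⟩
    q * (r + t + c) + r * t ≡⟨ expand c r t q ⟩
    c * q + r * q + t * q + r * t ∎
  where
  open ≤-Reasoning
  expand : ∀ c r t q → q * (r + t + c) + r * t ≡ c * q + r * q + t * q + r * t
  expand = solve-∀

-- The leftover bound for min(m, n) = m = (c₁ + u) + q·b in the case with carry,
-- where b = c₁ + c₂ + u with c₂ ≥ 1 (the digit of m is below b).
min-carry : ∀ c₁ c₂ u {b q p} → b ≡ c₁ + suc c₂ + u → q ≤ p →
  c₁ + u + q * b ≤ c₁ * (suc q ⊓ p) + suc c₂ * (q ⊓ suc p) + u * (suc q ⊓ suc p) + c₁ * suc c₂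
min-carry c₁ c₂ u {q = q} {p} refl q≤p
  rewrite m≤n⇒m⊓n≡m (m≤n⇒m≤1+n q≤p) | m≤n⇒m⊓n≡m q≤p = begin
    c₁ + u + q * (c₁ + suc c₂ + u)
      ≡⟨ expand c₁ (suc c₂) u q ⟩
    c₁ * q + suc c₂ * q + u * suc q + c₁
      ≤⟨ +-mono-≤ (+-monoˡ-≤ (u * suc q) (+-monoˡ-≤ (suc c₂ * q) (*-monoʳ-≤ c₁ q≤min)))
                  (m≤m*n c₁ (suc c₂)) ⟩
    c₁ * (suc q ⊓ p) + suc c₂ * q + u * suc q + c₁ * suc c₂ ∎
  where
  open ≤-Reasoning
  expand : ∀ c₁ c₂ u q → c₁ + u + q * (c₁ + c₂ + u) ≡ c₁ * q + c₂ * q + u * suc q + c₁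
  expand = solve-∀
  q≤min : q ≤ suc q ⊓ p
  q≤min = ⊓-glb (n≤1+n q) q≤p

-- Two digits r, t < b whose sum reaches b split as r = c₁ + u, t = c₂ + u and
-- b = c₁ + c₂ + u, where u = r + t − b is the digit left after the carry and
-- c₂ = b − r is positive.
record CarrySplit (b r t : ℕ) : Set where
  field
    c₁ c₂ u : ℕ
    b≡ : b ≡ c₁ + suc c₂ + u
    r≡ : r ≡ c₁ + u
    t≡ : t ≡ suc c₂ + u

carry-split : ∀ {b r t} → r < b → t < b → b ≤ r + t → CarrySplit b r t
carry-split {b} {r} {t} r<b t<b b≤r+t
  with m≤n⇒∃[o]m+o≡n r<b | m≤n⇒∃[o]m+o≡n b≤r+t
... | c₂ , refl | u , b+u≡r+t with m≤n⇒∃[o]m+o≡n u≤r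
  where
  u≤r : u ≤ r
  u≤r = +-cancelˡ-≤ (suc r + c₂) u r (begin
    suc r + c₂ + u ≡⟨ b+u≡r+t ⟩
    r + t          ≤⟨ +-monoʳ-≤ r (<⇒≤ t<b) ⟩
    r + (suc r + c₂) ≡⟨ +-comm r _ ⟩
    suc r + c₂ + r ∎)
    where open ≤-Reasoning
... | c₁ , refl = record
  { c₁ = c₁ ; c₂ = c₂ ; u = u
  ; b≡ = reorder u c₁ c₂
  ; r≡ = +-comm u c₁
  ; t≡ = +-cancelˡ-≡ (u + c₁) t (suc c₂ + u) (sym (trans (overflow u c₁ c₂) b+u≡r+t))
  }
  where
  reorder : ∀ u c₁ c₂ → suc (u + c₁) + c₂ ≡ c₁ + suc c₂ + u
  reorder = solve-∀
  overflow : ∀ u c₁ c₂ → u + c₁ + (suc c₂ + u) ≡ suc (u + c₁) + c₂ + u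
  overflow = solve-∀

module _ (b : ℕ) .{{_ : NonZero b}} (2≤b : 2 ≤ b) where

  fuel-irrelevant : ∀ f g n → n ≤ f → n ≤ g → digitSumFuel b f n ≡ digitSumFuel b g n
  fuel-irrelevant zero    zero    zero    _ _ = refl
  fuel-irrelevant zero    (suc g) zero    _ _ = refl
  fuel-irrelevant (suc f) zero    zero    _ _ = refl
  fuel-irrelevant (suc f) (suc g) zero    _ _ = refl
  fuel-irrelevant (suc f) (suc g) (suc n) (s≤s n≤f) (s≤s n≤g) =
    cong (suc n % b +_) (fuel-irrelevant f g (suc n / b) (≤-trans quot≤n n≤f) (≤-trans quot≤n n≤g))
    where
    quot≤n : suc n / b ≤ n
    quot≤n = ≤-pred (m/n<m (suc n) b 2≤b)

  s-step : ∀ n → s b n ≡ n % b + s b (n / b)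
  s-step zero = sym (cong₂ (λ x y → x + s b y) (m<n⇒m%n≡m (≤-trans (s≤s z≤n) 2≤b)) (0/n≡0 b))
  s-step (suc n) = cong (suc n % b +_)
    (fuel-irrelevant n (suc n / b) (suc n / b) (≤-pred (m/n<m (suc n) b 2≤b)) ≤-refl)

  s-digit : ∀ r q → r < b → s b (r + q * b) ≡ r + s b q
  s-digit r q r<b = begin
    s b (r + q * b)                         ≡⟨ s-step (r + q * b) ⟩
    (r + q * b) % b + s b ((r + q * b) / b) ≡⟨ cong₂ (λ x y → x + s b y) last-digit quotient ⟩
    r + s b q ∎
    where
    open ≡-Reasoning
    last-digit : (r + q * b) % b ≡ r
    last-digit = trans ([m+kn]%n≡m%n r q b) (m<n⇒m%n≡m r<b)
    quotient : (r + q * b) / b ≡ q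
    quotient = begin
      (r + q * b) / b   ≡⟨ +-distrib-/-∣ʳ r (divides q refl) ⟩
      r / b + q * b / b ≡⟨ cong₂ _+_ (m<n⇒m/n≡0 r<b) (m*n/n≡m q b) ⟩
      q ∎

  -- The closed form of S_b on r + k·b (0 ≤ r ≤ b): the numbers below it are the
  -- j·b + d with j < k, d < b, contributing b·S(k) + k·tri(b), and the r numbers
  -- k·b + d with d < r, contributing r·s(k) + tri(r).
  S-digits : ∀ k r → r ≤ b → S b (r + k * b) ≡ b * S b k + k * tri b + r * s b k + tri r
  S-digits zero    zero    _   = sym (cong (λ x → x + 0 + 0 + 0) (*-zeroʳ b))
  S-digits (suc k) zero    _   =
    trans (S-digits k b ≤-refl) (close b (S b k) (s b k) k (tri b))
    where
    close : ∀ b A a k T → b * A + k * T + b * a + T ≡ b * (A + a) + suc k * T + 0 * 0 + 0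
    close = solve-∀
  S-digits k       (suc r) r<b = begin
    S b (r + k * b) + s b (r + k * b)
      ≡⟨ cong₂ _+_ (S-digits k r (<⇒≤ r<b)) (s-digit r k r<b) ⟩
    b * S b k + k * tri b + r * s b k + tri r + (r + s b k)
      ≡⟨ step (b * S b k + k * tri b) (s b k) r (tri r) ⟩
    b * S b k + k * tri b + suc r * s b k + (tri r + r) ∎
    where
    open ≡-Reasoning
    step : ∀ x a r y → x + r * a + y + (r + a) ≡ x + suc r * a + (y + r)
    step = solve-∀

  Bound : ℕ → ℕ → Set
  Bound x y = S b x + S b y + x ⊓ y ≤ S b (x + y)

  Smaller : ℕ → ℕ → Set
  Smaller m n = ∀ x y → x + y < m + n → Bound x y

  Bound-sym : ∀ {x y} → Bound x y → Bound y x
  Bound-sym {x} {y} h = begin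
    S b y + S b x + y ⊓ x ≡⟨ cong₂ _+_ (+-comm (S b y) (S b x)) (⊓-comm y x) ⟩
    S b x + S b y + x ⊓ y ≤⟨ h ⟩
    S b (x + y)           ≡⟨ cong (S b) (+-comm x y) ⟩
    S b (y + x)           ∎
    where open ≤-Reasoning

  -- A weighted instance of the inequality; it is only needed when the weight is positive.
  weighted : ∀ w x y {z} → x + y ≡ z → (1 ≤ w → Bound x y) →
    w * (S b x + S b y + x ⊓ y) ≤ w * S b z
  weighted zero    _ _ _    _ = z≤n
  weighted (suc w) _ _ refl h = *-monoʳ-≤ (suc w) (h (s≤s z≤n))

  module Step (m n : ℕ) (0<m : 0 < m) (m≤n : m ≤ n) (IH : Smaller m n) where
    instance
      m-nonZero : NonZero m
      m-nonZero = >-nonZero 0<m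
      n-nonZero : NonZero n
      n-nonZero = >-nonZero (≤-trans 0<m m≤n)

    q = m / b
    r = m % b
    p = n / b
    t = n % b

    m≡ : m ≡ r + q * b
    m≡ = m≡m%n+[m/n]*n m b
    n≡ : n ≡ t + p * b
    n≡ = m≡m%n+[m/n]*n n b
    r<b : r < b
    r<b = m%n<n m b
    t<b : t < b
    t<b = m%n<n n b
    q≤p : q ≤ p
    q≤p = /-monoˡ-≤ b m≤n
    q<m : q < m
    q<m = m/n<m m b 2≤b
    p<n : p < n
    p<n = m/n<m n b 2≤b

    below-m : ∀ k → k ≤ r → k + q ≤ m
    below-m k k≤r = subst (k + q ≤_) (sym m≡) (+-mono-≤ k≤r (m≤m*n q b))
    below-n : ∀ k → k ≤ t → k + p ≤ n
    below-n k k≤t = subst (k + p ≤_) (sym n≡) (+-mono-≤ k≤t (m≤m*n p b))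

    S-m : S b m ≡ b * S b q + q * tri b + r * s b q + tri r
    S-m = trans (cong (S b) m≡) (S-digits q r (<⇒≤ r<b))
    S-n : S b n ≡ b * S b p + p * tri b + t * s b p + tri t
    S-n = trans (cong (S b) n≡) (S-digits p t (<⇒≤ t<b))

    m+n≡ : m + n ≡ r + t + (q + p) * b
    m+n≡ = trans (cong₂ _+_ m≡ n≡) (regroup r q b t p)
      where
      regroup : ∀ r q b t p → r + q * b + (t + p * b) ≡ r + t + (q + p) * b
      regroup = solve-∀

    min≡m : m ⊓ n ≡ m
    min≡m = m≤n⇒m⊓n≡m m≤n

    same-quotient : q ≡ p → r ≤ t
    same-quotient q≡p = +-cancelʳ-≤ (q * b) r t
      (subst (λ k → r + q * b ≤ t + k * b) (sym q≡p) (subst₂ _≤_ m≡ n≡ m≤n))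

    -- No carry: m + n = (r + t) + (q + p)·b, with weights c, r, t on the pairs
    -- (q, p), (q + 1, p), (q, p + 1), where b = r + t + c.
    no-carry : r + t < b → Bound m n
    no-carry r+t<b with c , r+t+c≡b ← m≤n⇒∃[o]m+o≡n (<⇒≤ r+t<b) = begin
      S b m + S b n + m ⊓ n
        ≡⟨ cong₂ (λ x y → x + y + m ⊓ n) S-m S-n ⟩
      (b * S b q + q * tri b + r * s b q + tri r) + (b * S b p + p * tri b + t * s b p + tri t) + m ⊓ n
        ≤⟨ no-carry-combine {c = c} {r} {t} {q} {p} (sym r+t+c≡b) h₀ h₁ h₂ hM ⟩
      b * S b (q + p) + (q + p) * tri b + (r + t) * s b (q + p) + tri (r + t)
        ≡⟨ sym (trans (cong (S b) m+n≡) (S-digits (q + p) (r + t) (<⇒≤ r+t<b))) ⟩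
      S b (m + n) ∎
      where
      open ≤-Reasoning
      h₀ : c * (S b q + S b p + q ⊓ p) ≤ c * S b (q + p)
      h₀ = weighted c q p refl (λ _ → IH q p (+-mono-<-≤ q<m (<⇒≤ p<n)))
      h₁ : r * (S b (suc q) + S b p + suc q ⊓ p) ≤ r * S b (suc (q + p))
      h₁ = weighted r (suc q) p refl (λ r≥1 → IH (suc q) p (+-mono-≤-< (below-m 1 r≥1) p<n))
      h₂ : t * (S b q + S b (suc p) + q ⊓ suc p) ≤ t * S b (suc (q + p))
      h₂ = weighted t q (suc p) (+-suc q p) (λ t≥1 → IH q (suc p) (+-mono-<-≤ q<m (below-n 1 t≥1)))
      hM : m ⊓ n ≤ c * (q ⊓ p) + r * (suc q ⊓ p) + t * (q ⊓ suc p) + r * t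
      hM = ≤-trans (≤-reflexive (trans min≡m m≡))
             (min-no-carry r t c (sym r+t+c≡b) q≤p same-quotient)

    -- Carry: m + n = u + (q + p + 1)·b, with weights c₁, c₂, u on the pairs
    -- (q + 1, p), (q, p + 1), (q + 1, p + 1), where b = c₁ + c₂ + u.
    carry : b ≤ r + t → Bound m n
    carry b≤r+t with carry-split r<b t<b b≤r+t
    ... | record { c₁ = c₁ ; c₂ = c₂ ; u = u ; b≡ = b≡ ; r≡ = r≡ ; t≡ = t≡ } = begin
      S b m + S b n + m ⊓ n
        ≡⟨ cong₂ (λ x y → x + y + m ⊓ n) S-m S-n ⟩
      (b * S b q + q * tri b + r * s b q + tri r) + (b * S b p + p * tri b + t * s b p + tri t) + m ⊓ n
        ≤⟨ carry-combine {c₁ = c₁} {suc c₂} {u} {q} {p} b≡ r≡ t≡ h₁ h₂ h₃ hM ⟩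
      b * S b (suc (q + p)) + suc (q + p) * tri b + u * s b (suc (q + p)) + tri u
        ≡⟨ sym (trans (cong (S b) m+n≡′) (S-digits (suc (q + p)) u u≤b)) ⟩
      S b (m + n) ∎
      where
      open ≤-Reasoning
      u≤b : u ≤ b
      u≤b = subst (u ≤_) (sym b≡) (m≤n+m u (c₁ + suc c₂))
      m+n≡′ : m + n ≡ u + suc (q + p) * b
      m+n≡′ = trans m+n≡ (begin-equality
        r + t + (q + p) * b
          ≡⟨ cong (λ x → x + (q + p) * b) (cong₂ _+_ r≡ t≡) ⟩
        c₁ + u + (suc c₂ + u) + (q + p) * b
          ≡⟨ regroup c₁ c₂ u (q + p) b ⟩
        u + (c₁ + suc c₂ + u) + (q + p) * b
          ≡⟨ cong (λ x → u + x + (q + p) * b) (sym b≡) ⟩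
        u + b + (q + p) * b
          ≡⟨ +-assoc u b ((q + p) * b) ⟩
        u + suc (q + p) * b ∎)
        where
        regroup : ∀ c₁ c₂ u k b → c₁ + u + (suc c₂ + u) + k * b ≡ u + (c₁ + suc c₂ + u) + k * b
        regroup = solve-∀
      r≥1 : 1 ≤ c₁ + u → 1 ≤ r
      r≥1 = subst (1 ≤_) (sym r≡)
      t≥1+u : suc u ≤ t
      t≥1+u = subst (suc u ≤_) (sym t≡) (s≤s (m≤n+m u c₂))
      h₁ : c₁ * (S b (suc q) + S b p + suc q ⊓ p) ≤ c₁ * S b (suc (q + p))
      h₁ = weighted c₁ (suc q) p refl (λ c₁≥1 →
             IH (suc q) p (+-mono-≤-< (below-m 1 (r≥1 (≤-trans c₁≥1 (m≤m+n c₁ u)))) p<n))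
      h₂ : suc c₂ * (S b q + S b (suc p) + q ⊓ suc p) ≤ suc c₂ * S b (suc (q + p))
      h₂ = weighted (suc c₂) q (suc p) (+-suc q p) (λ _ →
             IH q (suc p) (+-mono-<-≤ q<m (below-n 1 (≤-trans (s≤s z≤n) t≥1+u))))
      h₃ : u * (S b (suc q) + S b (suc p) + suc q ⊓ suc p) ≤ u * S b (suc (suc (q + p)))
      h₃ = weighted u (suc q) (suc p) (cong suc (+-suc q p)) (λ u≥1 →
             IH (suc q) (suc p) (+-mono-≤-< (below-m 1 (r≥1 (≤-trans u≥1 (m≤n+m u c₁))))
                                            (below-n 2 (≤-trans (s≤s u≥1) t≥1+u))))
      hM : m ⊓ n ≤ c₁ * (suc q ⊓ p) + suc c₂ * (q ⊓ suc p) + u * (suc q ⊓ suc p) + c₁ * suc c₂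
      hM = ≤-trans (≤-reflexive (trans min≡m (trans m≡ (cong (_+ q * b) r≡))))
             (min-carry c₁ c₂ u b≡ q≤p)

    bound : Bound m n
    bound with r + t <? b
    ... | yes r+t<b = no-carry r+t<b
    ... | no  r+t≮b = carry (≮⇒≥ r+t≮b)

  ordered-step : ∀ m n → m ≤ n → Smaller m n → Bound m n
  ordered-step zero    n _   _  = ≤-reflexive (+-identityʳ (S b n))
  ordered-step (suc m) n m≤n IH = Step.bound (suc m) n (s≤s z≤n) m≤n IH

  inductive-step : ∀ m n → Smaller m n → Bound m n
  inductive-step m n IH with ≤-total m n
  ... | inj₁ m≤n = ordered-step m n m≤n IH
  ... | inj₂ n≤m = Bound-sym {n} {m} (ordered-step n m n≤m
                     (λ x y lt → IH x y (subst (x + y <_) (+-comm n m) lt)))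

  bound : ∀ m n → Bound m n
  bound m n = <-rec (λ N → ∀ x y → x + y ≡ N → Bound x y) induct (m + n) m n refl
    where
    induct : ∀ N → (∀ {N′} → N′ < N → ∀ x y → x + y ≡ N′ → Bound x y) →
      ∀ x y → x + y ≡ N → Bound x y
    induct _ rec x y refl = inductive-step x y (λ x′ y′ lt → rec lt x′ y′ refl)

theorem1 : (b : ℕ) → .{{_ : NonZero b}} → 2 ≤ b → (m n : ℕ) →
    S b m + S b n + (m ⊓ n) ≤ S b (m + n)
theorem1 b 2≤b m n = bound b 2≤b m n
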